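{- For any finite simplicial complex $\Delta$ with vertices in $\mathbb{N}$ one has $f_d(\mathrm{Inc}(\Delta))\ge \mathrm{Inc}^{[d+1]}(f_d(\Delta))$ for all $d\ge0$.
   Context: $\mathbb{N}=\{1,2,\dots\}$; $d$-subsets are written $\mathbf{u}=(u_1,\dots,u_d)$ with $u_1<\dots<u_d$. A simplicial complex is a finite collection of finite subsets of $\mathbb{N}$ closed under taking subsets; $F_d(\Delta)$ is the set of faces with exactly $d$ elements, and $f_{d-1}(\Delta)=|F_d(\Delta)|$. $\mathrm{Inc}_1$ is the set of maps $\pi:\mathbb{N}\to\mathbb{N}$ with $\pi(j)<\pi(j+1)$, $\pi(j)\le j+1$ for all $j$, acting by $\pi(\mathbf{u})=(\pi(u_1),\dots,\pi(u_d))$; $\mathrm{Inc}(\mathcal{F})=\{\pi(\mathbf{u})\mid\mathbf{u}\in\mathcal{F},\pi\in\mathrm{Inc}_1\}$ and $\mathrm{Inc}(\Delta)=\bigcup_{d\ge1}\mathrm{Inc}(F_d(\Delta))$. For $e\ge1$, every positive integer $m$ has a unique $e$-binomial representation $m=\binom{a_e}{e}+\binom{a_{e-1}}{e-1}+\cdots+\binom{a_s}{s}$ with $a_e>\cdots>a_s\ge s\ge1$; then $\mathrm{Inc}^{[e]}(m)=\binom{a_e+1}{e}+\cdots+\binom{a_s+1}{s}$, and $\mathrm{Inc}^{[e]}(0)=0$. -}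

module Defs where

open import Data.Nat using (ℕ; zero; suc; _+_; _≤_; _<_; _∸_; _≟_)
open import Data.Nat.Combinatorics using (_C_)
open import Data.List using (List; []; _∷_; map; length; filter)
open import Data.List.Relation.Unary.All using (All)
open import Data.List.Relation.Unary.Linked using (Linked)
open import Data.List.Relation.Unary.Unique.Propositional using (Unique)
open import Data.List.Relation.Binary.Sublist.Propositional using (_⊆_)
open import Data.List.Membership.Propositional using (_∈_)
open import Data.Product using (Σ; _×_; ∃)
open import Relation.Binary.PropositionalEquality using (_≡_)

-- A finite subset of ℕ = {1,2,...} is represented by its elements listed in
-- strictly increasing order (so the representation is canonical).
IsFace : List ℕ → Set
IsFace u = Linked _<_ u × All (1 ≤_) u

-- A finite simplicial complex: a duplicate-free finite list of faces, closed
-- under taking subsets (subsets of a sorted list = its sublists).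
record IsComplex (Δ : List (List ℕ)) : Set where
  field
    faces  : All IsFace Δ
    unique : Unique Δ
    closed : ∀ {u v} → u ∈ Δ → v ⊆ u → v ∈ Δ

F : ℕ → List (List ℕ) → List (List ℕ)
F d Δ = filter (λ u → length u ≟ d) Δ

-- f d Δ = f_d(Δ) = number of faces with d+1 elements.
f : ℕ → List (List ℕ) → ℕ
f d Δ = length (F (suc d) Δ)

-- Inc_1: maps π : ℕ → ℕ (only values on positive integers matter) with
-- π(1) ≥ 1, π(j) < π(j+1) and π(j) ≤ j+1 for all j ≥ 1.
record IsInc1 (π : ℕ → ℕ) : Set where
  field
    pos  : 1 ≤ π 1
    incr : ∀ j → 1 ≤ j → π j < π (suc j)
    bnd  : ∀ j → 1 ≤ j → π j ≤ suc j

InInc : List (List ℕ) → List ℕ → Set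
InInc Δ v = Σ (List ℕ) λ u → u ∈ Δ × 1 ≤ length u ×
              (Σ (ℕ → ℕ) λ π → IsInc1 π × v ≡ map π u)

-- e-binomial representation m = C(a_e,e) + C(a_{e-1},e-1) + ... + C(a_s,s),
-- encoded as the list [a_e, a_{e-1}, ..., a_s].
-- Rep e as : a_e > a_{e-1} > ... > a_s ≥ s ≥ 1.
data Rep : ℕ → List ℕ → Set where
  last : ∀ {e a} → 1 ≤ e → e ≤ a → Rep e (a ∷ [])
  cons : ∀ {e a b as} → b < a → Rep e (b ∷ as) → Rep (suc e) (a ∷ b ∷ as)

binSum : ℕ → List ℕ → ℕ
binSum e []       = 0
binSum e (a ∷ as) = a C e + binSum (e ∸ 1) as

-- Σ_i C(a_i + 1, i), i.e. Inc^[e](m) when as is the e-binomial rep. of m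
incSum : ℕ → List ℕ → ℕ
incSum e []       = 0
incSum e (a ∷ as) = suc a C e + incSum (e ∸ 1) as

module Submission where

-- A face u = (u₁ < ⋯ < u_k) of positive integers is encoded by
-- its gap vector (u₁ - 1, u₂ - u₁ - 1, …, u_k - u_{k-1} - 1) ∈ ℕ^k.  A map
-- π ∈ Inc₁ either fixes u or shifts all entries from some position on by one,
-- so in gap coordinates the Inc₁-images of u are exactly u and the unit steps
-- u + e_j.  Hence f_d(Inc Δ) is the size of the unit-step shadow of the family
-- of gap vectors of the (d+1)-faces, and the corollary reduces to a
-- Macaulay-type bound |shadow G| ≥ Inc^[e](|G|) for finite families G ⊆ ℕ^e.
--
-- The Macaulay bound is proved in the monotone form
--   |G| + Inc^[e](m) ≤ |L| + m   for every e-binomial sum m ≤ |G|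
-- and every duplicate-free L containing the shadow of G, by induction on e
-- and, for fixed e, by induction on a bound for |G| + weight G (the sum of
-- first coordinates).  If G is not compressed along some line direction,
-- compressing it keeps |G|, does not enlarge the shadow and lowers the
-- weight.  If G is compressed in every direction, splitting G according to
-- whether the first coordinate vanishes reduces the claim to dimension e - 1
-- and to a lighter family in dimension e; the two are combined by Pascal's
-- rule on binomial representations.

open import Defs
open import Data.Nat using (ℕ; zero; suc; pred; _+_; _≤_; _<_; _∸_; _≟_; _≤?_; _<?_; _⊔_; z≤n; s≤s)
open import Data.Nat.Properties
open import Algebra.Properties.CommutativeSemigroup +-commutativeSemigroup using (interchange)
open import Data.Nat.ListAction using (sum)
open import Data.Nat.ListAction.Properties using (sum-++)
open import Data.Nat.Combinatorics using (_C_; nCk+nC[k+1]≡[n+1]C[k+1]; nCn≡1; nC1≡n; nCk≡nC[n∸k])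
open import Data.Nat.Tactic.RingSolver using (solve-∀)
open import Data.List using (List; []; _∷_; map; length; filter; _++_; concat; concatMap; downFrom; deduplicate)
open import Data.List.Properties using (≡-dec; length-map; length-++; length-downFrom; map-++; map-∘; map-cong; map-cong-local; ∷-injectiveˡ; ∷-injectiveʳ)
open import Data.List.Extrema.Nat using (argmax; argmax-sel; f[⊥]≤f[argmax]; f[xs]≤f[argmax])
open import Data.List.Relation.Unary.All as All using (All; []; _∷_; all?)
open import Data.List.Relation.Unary.Any using (here; there; any?)
open import Data.List.Relation.Unary.All.Properties using (¬Any⇒All¬; ¬All⇒Any¬; all-filter)
open import Data.List.Relation.Unary.Unique.Propositional using (Unique)
open import Data.List.Relation.Unary.Unique.Propositional.Properties using (map⁺; filter⁺; ++⁺; downFrom⁺)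
open import Data.List.Relation.Unary.Unique.DecPropositional.Properties (≡-dec _≟_) using (deduplicate-!)
open import Data.List.Membership.DecPropositional (≡-dec _≟_) using (_∈?_)
open import Data.List.Relation.Unary.AllPairs using ([]; _∷_)
open import Data.List.Relation.Unary.Linked as Linked using (Linked)
open import Data.List.Relation.Unary.Linked.Properties using (Linked⇒AllPairs)
open import Data.List.Relation.Binary.Subset.Propositional using (_⊆_)
open import Data.List.Membership.Propositional using (_∈_; _∉_; find)
open import Data.List.Membership.Propositional.Properties
open import Data.Product using (Σ; _×_; _,_; proj₁; proj₂)
open import Data.Sum using (_⊎_; inj₁; inj₂; [_,_]′)
open import Data.Empty using (⊥; ⊥-elim)
open import Function.Bundles using (_⇔_; mk⇔)
open import Relation.Nullary using (¬_; Dec; yes; no; does; ¬?)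
open import Data.Bool using (true; false; if_then_else_)
open import Function using (_∘′_; case_of_)
open import Relation.Binary.Definitions using (DecidableEquality)
open import Relation.Binary.PropositionalEquality using (_≡_; _≢_; refl; sym; trans; cong; cong₂; subst; subst₂; module ≡-Reasoning)

remove : {A : Set} {x : A} (xs : List A) → x ∈ xs → List A
remove (_ ∷ ys) (here _)  = ys
remove (y ∷ ys) (there p) = y ∷ remove ys p

length-remove : {A : Set} {x : A} (xs : List A) (p : x ∈ xs) → length xs ≡ suc (length (remove xs p))
length-remove (_ ∷ _)  (here _)  = refl
length-remove (_ ∷ ys) (there p) = cong suc (length-remove ys p)

∈-remove⁺ : {A : Set} {x y : A} (xs : List A) (p : x ∈ xs) → y ∈ xs → y ≢ x → y ∈ remove xs p
∈-remove⁺ (_ ∷ _)  (here refl) (here refl) y≢x = ⊥-elim (y≢x refl)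
∈-remove⁺ (_ ∷ _)  (here refl) (there q)   _   = q
∈-remove⁺ (_ ∷ _)  (there p)   (here refl) _   = here refl
∈-remove⁺ (_ ∷ zs) (there p)   (there q)   y≢x = there (∈-remove⁺ zs p q y≢x)

∈-remove⁻ : {A : Set} {x y : A} (xs : List A) (p : x ∈ xs) → y ∈ remove xs p → y ∈ xs
∈-remove⁻ (_ ∷ _)  (here _)  q           = there q
∈-remove⁻ (_ ∷ _)  (there p) (here refl) = here refl
∈-remove⁻ (_ ∷ zs) (there p) (there q)   = there (∈-remove⁻ zs p q)

sum-remove : {x : ℕ} (xs : List ℕ) (p : x ∈ xs) → sum xs ≡ x + sum (remove xs p)
sum-remove (_ ∷ _)  (here refl) = refl
sum-remove {x} (z ∷ zs) (there p) = begin
  z + sum zs                   ≡⟨ cong (z +_) (sum-remove zs p) ⟩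
  z + (x + sum (remove zs p))  ≡⟨ +-comm z _ ⟩
  (x + sum (remove zs p)) + z  ≡⟨ +-assoc x _ z ⟩
  x + (sum (remove zs p) + z)  ≡⟨ cong (x +_) (+-comm _ z) ⟩
  x + (z + sum (remove zs p))  ∎
  where open ≡-Reasoning

remove-unique : {A : Set} {x : A} (xs : List A) (p : x ∈ xs) → Unique xs → Unique (remove xs p)
remove-unique (_ ∷ _)  (here _)  (_ ∷ u)      = u
remove-unique (_ ∷ zs) (there p) (z∉zs ∷ u) =
  All.tabulate (λ q → All.lookup z∉zs (∈-remove⁻ zs p q)) ∷ remove-unique zs p u

unique-⊆⇒length≤ : {A : Set} {xs ys : List A} → Unique xs → xs ⊆ ys → length xs ≤ length ys
unique-⊆⇒length≤ {xs = []} _ _ = z≤n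
unique-⊆⇒length≤ {xs = x ∷ xs} {ys} (x∉xs ∷ u) xs⊆ys = begin
  suc (length xs)                       ≤⟨ s≤s (unique-⊆⇒length≤ u xs⊆ys-x) ⟩
  suc (length (remove ys x∈ys))         ≡⟨ length-remove ys x∈ys ⟨
  length ys                             ∎
  where
    open ≤-Reasoning
    x∈ys : x ∈ ys
    x∈ys = xs⊆ys (here refl)
    xs⊆ys-x : xs ⊆ remove ys x∈ys
    xs⊆ys-x z∈xs = ∈-remove⁺ ys x∈ys (xs⊆ys (there z∈xs)) (λ z≡x → All.lookup x∉xs z∈xs (sym z≡x))

unique-bounded⇒length≤ : {P : List ℕ} {t : ℕ} → Unique P → (∀ {p} → p ∈ P → p < t) → length P ≤ t
unique-bounded⇒length≤ {t = t} u below =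
  subst (_ ≤_) (length-downFrom t) (unique-⊆⇒length≤ u (λ p∈P → ∈-downFrom⁺ (below p∈P)))

-- triangle n = (n-1) + ⋯ + 1 + 0, the least possible sum of n distinct naturals.
triangle : ℕ → ℕ
triangle n = sum (downFrom n)

maximiser : {A : Set} (f : A → ℕ) (xs : List A) → 0 < length xs →
            Σ A λ m → m ∈ xs × (∀ {y} → y ∈ xs → f y ≤ f m)
maximiser f (x ∷ xs) _ =
  argmax f x xs , [ here , there ]′ (argmax-sel f x xs) ,
  λ { (here refl) → f[⊥]≤f[argmax] {f = f} x xs ; (there p) → All.lookup (f[xs]≤f[argmax] {f = f} x xs) p }

-- Removing the maximum M of a list P of n+1 distinct naturals leaves n of
-- them, and M ≥ n by pigeonhole; this is the inductive step for the bounds below.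
module RemoveMax (x : ℕ) (xs : List ℕ) (u : Unique (x ∷ xs)) where
  private
    maximum : Σ ℕ λ m → m ∈ x ∷ xs × (∀ {y} → y ∈ x ∷ xs → y ≤ m)
    maximum = maximiser (λ y → y) (x ∷ xs) (s≤s z≤n)

    M∈ : proj₁ maximum ∈ x ∷ xs
    M∈ = proj₁ (proj₂ maximum)

  M : ℕ
  M = proj₁ maximum

  rest : List ℕ
  rest = remove (x ∷ xs) M∈

  length-rest : length rest ≡ length xs
  length-rest = suc-injective (sym (length-remove (x ∷ xs) M∈))

  sum-split : sum (x ∷ xs) ≡ M + sum rest
  sum-split = sum-remove (x ∷ xs) M∈

  rest-unique : Unique rest
  rest-unique = remove-unique (x ∷ xs) M∈ u

  ≤M : ∀ {q} → q ∈ x ∷ xs → q ≤ M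
  ≤M = proj₂ (proj₂ maximum)

  length≤M : length xs ≤ M
  length≤M = ≤-pred (unique-bounded⇒length≤ u (λ q → s≤s (≤M q)))

triangle≤sum : ∀ n (P : List ℕ) → length P ≡ n → Unique P → triangle n ≤ sum P
triangle≤sum zero    _        _  _ = z≤n
triangle≤sum (suc k) (x ∷ xs) eq u =
  subst (triangle (suc k) ≤_) (sym sum-split)
    (+-mono-≤ (subst (_≤ M) (suc-injective eq) length≤M)
              (triangle≤sum k rest (trans length-rest (suc-injective eq)) rest-unique))
  where open RemoveMax x xs u

triangle<sum : ∀ n (P : List ℕ) → length P ≡ n → Unique P → ∀ {q} → q ∈ P → n ≤ q → triangle n < sum P
triangle<sum zero    []       _  _ ()  _
triangle<sum (suc k) (x ∷ xs) eq u q∈P n≤q =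
  subst (triangle (suc k) <_) (sym sum-split)
    (+-mono-<-≤ (≤-trans n≤q (≤M q∈P))
                (triangle≤sum k rest (trans length-rest (suc-injective eq)) rest-unique))
  where open RemoveMax x xs u

unique⇒large : ∀ {P : List ℕ} {t} → Unique P → t < length P → Σ ℕ λ q → q ∈ P × t ≤ q
unique⇒large {P} {t} u t<len with any? (t ≤?_) P
... | yes some = find some
... | no none   = ⊥-elim (<⇒≱ t<len (unique-bounded⇒length≤ u (λ p∈P → ≰⇒> (All.lookup (¬Any⇒All¬ P none) p∈P))))

gap⇒large : ∀ {P : List ℕ} {x} → Unique P → x ∈ P → x ∸ 1 ∉ P → Σ ℕ λ q → q ∈ P × length P ≤ q
gap⇒large {P} {x} u x∈P x-1∉P with unique⇒large {t = length P} (All.tabulate (λ p eq → x-1∉P (subst (_∈ P) (sym eq) p)) ∷ u) ≤-refl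
... | q , here refl , len≤q = x , x∈P , ≤-trans len≤q (m∸n≤m x 1)
... | q , there q∈P , len≤q = q , q∈P , len≤q

map-unique-on : {A B : Set} (f : A → B) {xs : List A} → Unique xs →
                (∀ {a b} → a ∈ xs → b ∈ xs → f a ≡ f b → a ≡ b) → Unique (map f xs)
map-unique-on f {[]}     []        _   = []
map-unique-on f {x ∷ xs} (x∉ ∷ u) inj =
  All.tabulate (λ p fx≡ → let (y , y∈ , fy≡) = ∈-map⁻ f p in All.lookup x∉ y∈ (inj (here refl) (there y∈) (trans fx≡ fy≡)))
  ∷ map-unique-on f u (λ p q → inj (there p) (there q))

concatMap-unique : {A B : Set} (label : B → A) (g : A → List B) (ks : List A) → Unique ks →
                   (∀ {κ} → κ ∈ ks → Unique (g κ)) → (∀ {κ z} → κ ∈ ks → z ∈ g κ → label z ≡ κ) →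
                   Unique (concatMap g ks)
concatMap-unique label g []       _          _        _       = []
concatMap-unique label g (κ ∷ ks) (κ∉ks ∷ u) blocks labelled =
  ++⁺ (blocks (here refl)) (concatMap-unique label g ks u (blocks ∘′ there) (labelled ∘′ there)) disjoint
  where
    disjoint : ∀ {z} → z ∈ g κ × z ∈ concatMap g ks → ⊥
    disjoint (z∈gκ , z∈rest) with ∈-concat⁻′ (map g ks) z∈rest
    ... | _ , z∈block , block∈ with ∈-map⁻ g block∈
    ...   | κ' , κ'∈ , refl =
      All.lookup κ∉ks κ'∈ (trans (sym (labelled (here refl) z∈gκ)) (labelled (there κ'∈) z∈block))

length≡sum-ones : {A : Set} (xs : List A) → length xs ≡ sum (map (λ _ → 1) xs)
length≡sum-ones []       = refl
length≡sum-ones (_ ∷ xs) = cong suc (length≡sum-ones xs)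

sum-map-concat : {A : Set} (g : A → ℕ) (xss : List (List A)) →
                 sum (map g (concat xss)) ≡ sum (map (λ xs → sum (map g xs)) xss)
sum-map-concat g []         = refl
sum-map-concat g (xs ∷ xss) = begin
  sum (map g (xs ++ concat xss))              ≡⟨ cong sum (map-++ g xs (concat xss)) ⟩
  sum (map g xs ++ map g (concat xss))        ≡⟨ sum-++ (map g xs) _ ⟩
  sum (map g xs) + sum (map g (concat xss))   ≡⟨ cong (sum (map g xs) +_) (sum-map-concat g xss) ⟩
  sum (map g xs) + sum (map (λ xs → sum (map g xs)) xss) ∎
  where open ≡-Reasoning

sum-map-+ : {K : Set} (g h : K → ℕ) (ks : List K) →
            sum (map (λ κ → g κ + h κ) ks) ≡ sum (map g ks) + sum (map h ks)
sum-map-+ g h []       = refl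
sum-map-+ g h (κ ∷ ks) = trans (cong (g κ + h κ +_) (sum-map-+ g h ks)) (interchange (g κ) (h κ) _ _)

sum-map-mono-≤ : {K : Set} (g h : K → ℕ) (ks : List K) → (∀ {κ} → κ ∈ ks → g κ ≤ h κ) →
                 sum (map g ks) ≤ sum (map h ks)
sum-map-mono-≤ g h []       _   = z≤n
sum-map-mono-≤ g h (κ ∷ ks) g≤h = +-mono-≤ (g≤h (here refl)) (sum-map-mono-≤ g h ks (g≤h ∘′ there))

sum-map-mono-< : {K : Set} (g h : K → ℕ) (ks : List K) → (∀ {κ} → κ ∈ ks → g κ ≤ h κ) →
                 ∀ {κ₀} → κ₀ ∈ ks → g κ₀ < h κ₀ → sum (map g ks) < sum (map h ks)
sum-map-mono-< g h (κ ∷ ks) g≤h (here refl) g<h = +-mono-<-≤ g<h (sum-map-mono-≤ g h ks (λ p → g≤h (there p)))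
sum-map-mono-< g h (κ ∷ ks) g≤h (there p)   g<h = +-mono-≤-< (g≤h (here refl)) (sum-map-mono-< g h ks (λ q → g≤h (there q)) p g<h)

module Fibres {A K : Set} (_≟K_ : DecidableEquality K) (key : A → K) where

  fibre : K → List A → List A
  fibre κ X = filter (λ z → key z ≟K κ) X

  indicator : (A → ℕ) → A → K → ℕ
  indicator g x κ = if does (key x ≟K κ) then g x else 0

  fibre-∷ : ∀ (g : A → ℕ) x X κ → sum (map g (fibre κ (x ∷ X))) ≡ indicator g x κ + sum (map g (fibre κ X))
  fibre-∷ g x X κ with key x ≟K κ
  ... | yes _ = refl
  ... | no  _ = refl

  indicator-∉ : ∀ g x ks → key x ∉ ks → sum (map (indicator g x) ks) ≡ 0
  indicator-∉ g x []       _      = refl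
  indicator-∉ g x (κ ∷ ks) x∉κks with key x ≟K κ
  ... | yes eq = ⊥-elim (x∉κks (here eq))
  ... | no  _  = indicator-∉ g x ks (λ p → x∉κks (there p))

  indicator-∈ : ∀ g x ks → Unique ks → key x ∈ ks → sum (map (indicator g x) ks) ≡ g x
  indicator-∈ g x (κ ∷ ks) (κ∉ks ∷ u) p with key x ≟K κ
  indicator-∈ g x (κ ∷ ks) (κ∉ks ∷ u) p         | yes refl =
    trans (cong (g x +_) (indicator-∉ g x ks (λ q → All.lookup κ∉ks q refl))) (+-identityʳ (g x))
  indicator-∈ g x (κ ∷ ks) (κ∉ks ∷ u) (here eq)  | no ne = ⊥-elim (ne eq)
  indicator-∈ g x (κ ∷ ks) (κ∉ks ∷ u) (there p)  | no _  = indicator-∈ g x ks u p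

  sum-fibres : ∀ (g : A → ℕ) (ks : List K) → Unique ks → (X : List A) → (∀ {z} → z ∈ X → key z ∈ ks) →
               sum (map g X) ≡ sum (map (λ κ → sum (map g (fibre κ X))) ks)
  sum-fibres g ks u [] _ = sym (zeros ks)
    where
      zeros : ∀ ks → sum (map (λ κ → sum (map g (fibre κ []))) ks) ≡ 0
      zeros []       = refl
      zeros (_ ∷ ks) = zeros ks
  sum-fibres g ks u (x ∷ X) covers = begin
    g x + sum (map g X)
      ≡⟨ cong (g x +_) (sum-fibres g ks u X (covers ∘′ there)) ⟩
    g x + sum (map fibreSum ks)
      ≡⟨ cong (_+ sum (map fibreSum ks)) (sym (indicator-∈ g x ks u (covers (here refl)))) ⟩
    sum (map (indicator g x) ks) + sum (map fibreSum ks)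
      ≡⟨ sum-map-+ (indicator g x) fibreSum ks ⟨
    sum (map (λ κ → indicator g x κ + fibreSum κ) ks)
      ≡⟨ cong sum (map-cong (λ κ → sym (fibre-∷ g x X κ)) ks) ⟩
    sum (map (λ κ → sum (map g (fibre κ (x ∷ X)))) ks) ∎
    where
      open ≡-Reasoning
      fibreSum : K → ℕ
      fibreSum κ = sum (map g (fibre κ X))

-- Binomial representations

-- Unlike Rep it also admits the empty list and the index 0; such
-- representations arise when a representation is split by Pascal's rule.
data BinRep : ℕ → List ℕ → Set where
  empty  : ∀ {e} → BinRep e []
  single : ∀ {e a} → e ≤ a → BinRep e (a ∷ [])
  extend : ∀ {e a b bs} → b < a → BinRep e (b ∷ bs) → BinRep (suc e) (a ∷ b ∷ bs)

BinRep-head : ∀ {e a as} → BinRep e (a ∷ as) → e ≤ a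
BinRep-head (single e≤a)   = e≤a
BinRep-head (extend b<a r) = ≤-trans (s≤s (BinRep-head r)) b<a

Rep⇒BinRep : ∀ {e as} → Rep e as → BinRep e as
Rep⇒BinRep (last _ e≤a) = single e≤a
Rep⇒BinRep (cons b<a r) = extend b<a (Rep⇒BinRep r)

pascal : ∀ n k → suc n C suc k ≡ n C k + n C suc k
pascal n k = sym (nCk+nC[k+1]≡[n+1]C[k+1] n k)

C-positive : ∀ n k → k ≤ n → 1 ≤ n C k
C-positive n       zero    _         = ≤-refl
C-positive (suc n) (suc k) (s≤s k≤n) =
  subst (1 ≤_) (sym (pascal n k)) (≤-trans (C-positive n k k≤n) (m≤m+n _ _))

[1+n]Cn≡1+n : ∀ n → suc n C n ≡ suc n
[1+n]Cn≡1+n n = begin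
  suc n C n              ≡⟨ nCk≡nC[n∸k] (n≤1+n n) ⟩
  suc n C (suc n ∸ n)    ≡⟨ cong (suc n C_) (m+n∸n≡m 1 n) ⟩
  suc n C 1              ≡⟨ nC1≡n (suc n) ⟩
  suc n                  ∎
  where open ≡-Reasoning

-- Pascal's rule C(a+1, i) = C(a, i) + C(a, i-1) splits Inc^[e] into the
-- binomial sum itself and a sum of index e-1 over  lower e as = [a_e-1, …, a_1-1].
lower : ℕ → List ℕ → List ℕ
lower _       []       = []
lower zero    (_ ∷ _)  = []
lower (suc e) (a ∷ as) = pred a ∷ lower e as

lower-BinRep : ∀ {e as} → BinRep (suc e) as → BinRep e (lower (suc e) as)
lower-BinRep empty                  = empty
lower-BinRep (single (s≤s e≤a))     = single e≤a
lower-BinRep {zero}  (extend _ _)   = single z≤n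
lower-BinRep {suc e} (extend {a = suc a} {b = suc b} (s≤s b<a) r) = extend b<a (lower-BinRep r)
lower-BinRep {suc e} (extend {b = zero} _ r) with () ← BinRep-head r

-- All terms of index 0 equal 1, so Inc^[0] is the identity.
incSum₀ : ∀ {as} → BinRep 0 as → incSum 0 as ≡ binSum 0 as
incSum₀ empty      = refl
incSum₀ (single _) = refl

incSum-pascal : ∀ e {as} → BinRep e as → incSum e as ≡ binSum e as + incSum (e ∸ 1) (lower e as)
incSum-pascal zero    empty      = refl
incSum-pascal zero    (single _) = refl
incSum-pascal (suc e) empty      = refl
incSum-pascal (suc e) (single {a = suc a} _) =
  trans (cong (_+ 0) (pascal (suc a) e)) (regroup (suc a C e) (suc a C suc e))
  where
    regroup : ∀ x y → x + y + 0 ≡ y + 0 + (x + 0)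
    regroup = solve-∀
incSum-pascal (suc e) (extend {a = suc a} {b} {bs} _ r) =
  trans (cong₂ _+_ (pascal (suc a) e) (incSum-pascal e r))
        (regroup (suc a C e) (suc a C suc e) (binSum e (b ∷ bs)) (incSum (e ∸ 1) (lower e (b ∷ bs))))
  where
    regroup : ∀ x y z w → x + y + (z + w) ≡ y + z + (x + w)
    regroup = solve-∀

lowerSum≤binSum : ∀ e {as} → BinRep e as → binSum (e ∸ 1) (lower e as) ≤ binSum e as
lowerSum≤binSum zero    empty      = z≤n
lowerSum≤binSum zero    (single _) = z≤n
lowerSum≤binSum (suc e) empty      = z≤n
lowerSum≤binSum (suc e) (single {a = suc a} _) =
  +-monoˡ-≤ 0 (subst (a C e ≤_) (sym (pascal a e)) (m≤m+n _ _))
lowerSum≤binSum (suc e) (extend {a = suc a} _ r) =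
  +-mono-≤ (subst (a C e ≤_) (sym (pascal a e)) (m≤m+n _ _)) (lowerSum≤binSum e r)

-- If a_k = k then as = [k, k-1, …, s], and its lower part is a sum of at most k ones.
lowerSum≤index : ∀ k {bs} → BinRep k (k ∷ bs) → binSum (k ∸ 1) (lower k (k ∷ bs)) ≤ k
lowerSum≤index zero    _          = z≤n
lowerSum≤index (suc k) (single _) = subst (_≤ suc k) (sym (cong (_+ 0) (nCn≡1 k))) (s≤s z≤n)
lowerSum≤index (suc k) (extend {b = b} {bs} b<a r) with ≤-antisym (≤-pred b<a) (BinRep-head r)
... | refl = subst (_≤ suc k) (sym (cong (_+ binSum (k ∸ 1) (lower k (k ∷ bs))) (nCn≡1 k)))
                   (s≤s (lowerSum≤index k r))

-- It is again a representation and
-- stands for the complementary part of the Pascal split: see the two bounds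
-- upper+lower≤binSum+1 and upper+lower≤incSum below.
upper : ℕ → List ℕ → List ℕ
upper _       []       = []
upper zero    (_ ∷ _)  = []
upper (suc e) (a ∷ as) with a ≟ suc e
... | yes _ = suc e ∷ []
... | no  _ = pred a ∷ upper e as

upper-extend : ∀ e a b bs → b < a → suc e < a → BinRep e (b ∷ bs) → BinRep e (upper e (b ∷ bs)) →
               BinRep (suc e) (pred a ∷ upper e (b ∷ bs))
upper-extend zero    (suc a) b bs _ (s≤s e<a) _ _ = single e<a
upper-extend (suc e) (suc a) b bs _ (s≤s e<a) r r↑ with b ≟ suc e
... | yes refl = extend e<a r↑
upper-extend (suc e) (suc a) (suc b) bs (s≤s b<a) _ _ r↑ | no _ = extend b<a r↑
upper-extend (suc e) (suc a) zero    bs _ _ r _ | no _ with () ← BinRep-head r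

upper-BinRep : ∀ k {as} → BinRep k as → BinRep k (upper k as)
upper-BinRep zero    empty      = empty
upper-BinRep zero    (single _) = empty
upper-BinRep (suc e) empty      = empty
upper-BinRep (suc e) (single {a = a} e≤a) with a ≟ suc e
... | yes _ = single ≤-refl
upper-BinRep (suc e) (single {a = suc a} (s≤s e≤a)) | no a≢e = single (≤∧≢⇒< e≤a (λ e≡a → a≢e (cong suc (sym e≡a))))
upper-BinRep (suc e) (extend {a = a} {b} {bs} b<a r) with a ≟ suc e
... | yes _ = single ≤-refl
... | no a≢e = upper-extend e a b bs b<a (≤∧≢⇒< (BinRep-head (extend b<a r)) (λ e≡a → a≢e (sym e≡a))) r (upper-BinRep e r)

boundary-upper+lower≤binSum+1 : ∀ e {bs} → BinRep (suc e) (suc e ∷ bs) →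
  suc e C suc e + 0 + binSum e (lower (suc e) (suc e ∷ bs)) ≤ binSum (suc e) (suc e ∷ bs) + 1
boundary-upper+lower≤binSum+1 e {bs} r = begin
  suc e C suc e + 0 + A  ≡⟨ cong (λ c → c + 0 + A) (nCn≡1 (suc e)) ⟩
  1 + A                  ≡⟨ +-comm 1 A ⟩
  A + 1                  ≤⟨ +-monoˡ-≤ 1 (lowerSum≤binSum (suc e) r) ⟩
  binSum (suc e) (suc e ∷ bs) + 1 ∎
  where
    open ≤-Reasoning
    A : ℕ
    A = binSum e (lower (suc e) (suc e ∷ bs))

-- In the same boundary case the lower part is at most e+1, while Inc^[e+1](1) = e+2.
boundary-upper+lower≤incSum : ∀ e {bs} → BinRep (suc e) (suc e ∷ bs) →
  suc e C suc e + 0 + binSum e (lower (suc e) (suc e ∷ bs)) ≤ suc (suc e) C suc e + 0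
boundary-upper+lower≤incSum e {bs} r = begin
  suc e C suc e + 0 + A  ≡⟨ cong (λ c → c + 0 + A) (nCn≡1 (suc e)) ⟩
  suc A                  ≤⟨ s≤s (lowerSum≤index (suc e) r) ⟩
  suc (suc e)            ≡⟨ trans (+-identityʳ _) ([1+n]Cn≡1+n (suc e)) ⟨
  suc (suc e) C suc e + 0 ∎
  where
    open ≤-Reasoning
    A : ℕ
    A = binSum e (lower (suc e) (suc e ∷ bs))

upper+lower≤binSum+1 : ∀ k {as} → BinRep k as → binSum k (upper k as) + binSum (k ∸ 1) (lower k as) ≤ binSum k as + 1
upper+lower≤binSum+1 zero    empty      = z≤n
upper+lower≤binSum+1 zero    (single _) = z≤n
upper+lower≤binSum+1 (suc e) empty      = z≤n
upper+lower≤binSum+1 (suc e) r@(single {a = a} _) with a ≟ suc e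
... | yes refl = boundary-upper+lower≤binSum+1 e r
upper+lower≤binSum+1 (suc e) (single {a = suc a} _) | no _ =
  subst (λ c → a C suc e + 0 + (a C e + 0) ≤ c + 0 + 1) (sym (pascal a e))
        (≤-trans (≤-reflexive (regroup (a C suc e) (a C e))) (m≤m+n _ 1))
  where
    regroup : ∀ x y → x + 0 + (y + 0) ≡ y + x + 0
    regroup = solve-∀
upper+lower≤binSum+1 (suc e) r@(extend {a = a} _ _) with a ≟ suc e
... | yes refl = boundary-upper+lower≤binSum+1 e r
upper+lower≤binSum+1 (suc e) (extend {a = suc a} {b} {bs} _ r) | no _ =
  subst₂ _≤_ (regroup₁ (a C suc e) (a C e) _ _)
         (trans (regroup₂ (a C suc e) (a C e) (binSum e (b ∷ bs))) (cong (λ c → c + binSum e (b ∷ bs) + 1) (sym (pascal a e))))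
         (+-monoʳ-≤ (a C suc e + a C e) (upper+lower≤binSum+1 e r))
  where
    regroup₁ : ∀ x y z w → x + y + (z + w) ≡ x + z + (y + w)
    regroup₁ = solve-∀
    regroup₂ : ∀ x y z → x + y + (z + 1) ≡ y + x + z + 1
    regroup₂ = solve-∀
upper+lower≤binSum+1 (suc e) (extend {a = zero} () _) | no _

upper+lower≤incSum : ∀ k {as} → BinRep k as → binSum k (upper k as) + binSum (k ∸ 1) (lower k as) ≤ incSum k (upper k as)
upper+lower≤incSum zero    empty      = z≤n
upper+lower≤incSum zero    (single _) = z≤n
upper+lower≤incSum (suc e) empty      = z≤n
upper+lower≤incSum (suc e) r@(single {a = a} _) with a ≟ suc e
... | yes refl = boundary-upper+lower≤incSum e r
upper+lower≤incSum (suc e) (single {a = suc a} _) | no _ =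
  ≤-reflexive (trans (regroup (a C suc e) (a C e)) (cong (_+ 0) (sym (pascal a e))))
  where
    regroup : ∀ x y → x + 0 + (y + 0) ≡ y + x + 0
    regroup = solve-∀
upper+lower≤incSum (suc e) r@(extend {a = a} _ _) with a ≟ suc e
... | yes refl = boundary-upper+lower≤incSum e r
upper+lower≤incSum (suc e) (extend {a = suc a} {b} {bs} _ r) | no _ =
  subst₂ _≤_ (regroup (a C suc e) (a C e) _ _)
         (cong (_+ incSum e (upper e (b ∷ bs))) (trans (+-comm (a C suc e) (a C e)) (sym (pascal a e))))
         (+-monoʳ-≤ (a C suc e + a C e) (upper+lower≤incSum e r))
  where
    regroup : ∀ x y z w → x + y + (z + w) ≡ x + z + (y + w)
    regroup = solve-∀
upper+lower≤incSum (suc e) (extend {a = zero} () _) | no _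

-- A representation of 0 is empty, so its Inc-value is 0.
binSum≤0⇒incSum≡0 : ∀ k {as} → BinRep k as → binSum k as ≤ 0 → incSum k as ≡ 0
binSum≤0⇒incSum≡0 k empty _ = refl
binSum≤0⇒incSum≡0 k (single {a = a} k≤a) ≤0 with () ← ≤-trans (≤-trans (C-positive a k k≤a) (m≤m+n _ _)) ≤0
binSum≤0⇒incSum≡0 (suc k) r@(extend {a = a} _ _) ≤0
  with () ← ≤-trans (≤-trans (C-positive a (suc k) (BinRep-head r)) (m≤m+n _ _)) ≤0

-- Unit steps on vectors in ℕ^e

-- Vectors are lists of naturals; hd is the (total) first coordinate and
-- IsCons z says that z has a first coordinate at all.
hd : List ℕ → ℕ
hd []      = 0
hd (x ∷ _) = x

tl : List ℕ → List ℕ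
tl []      = []
tl (_ ∷ w) = w

IsCons : List ℕ → Set
IsCons z = Σ ℕ λ x → Σ (List ℕ) λ w → z ≡ x ∷ w

bump : ℕ → ℕ → List ℕ → List ℕ
bump _       _ []       = []
bump zero    n (y ∷ ys) = n + y ∷ ys
bump (suc j) n (y ∷ ys) = y ∷ bump j n ys

unbump : ℕ → ℕ → List ℕ → List ℕ
unbump _       _ []       = []
unbump zero    n (y ∷ ys) = y ∸ n ∷ ys
unbump (suc j) n (y ∷ ys) = y ∷ unbump j n ys

-- steps u: the vector u itself followed by the unit steps u + e_j.
steps : List ℕ → List (List ℕ)
steps []      = [] ∷ []
steps (x ∷ w) = map (x ∷_) (steps w) ++ ((suc x ∷ w) ∷ [])

length-bump : ∀ j n u → length (bump j n u) ≡ length u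
length-bump _       _ []       = refl
length-bump zero    _ (_ ∷ _)  = refl
length-bump (suc j) n (_ ∷ ys) = cong suc (length-bump j n ys)

length-unbump : ∀ j n u → length (unbump j n u) ≡ length u
length-unbump _       _ []       = refl
length-unbump zero    _ (_ ∷ _)  = refl
length-unbump (suc j) n (_ ∷ ys) = cong suc (length-unbump j n ys)

unbump-bump : ∀ j n w → unbump j n (bump j n w) ≡ w
unbump-bump _       _ []       = refl
unbump-bump zero    n (y ∷ ys) = cong (_∷ ys) (m+n∸m≡n n y)
unbump-bump (suc j) n (y ∷ ys) = cong (y ∷_) (unbump-bump j n ys)

bump-unbump-bump : ∀ j {t x} w → t ≤ x → bump j t (unbump j t (bump j x w)) ≡ bump j x w
bump-unbump-bump _       []       _   = refl
bump-unbump-bump zero    {x = x} (y ∷ ys) t≤x = cong (_∷ ys) (m+[n∸m]≡n (≤-trans t≤x (m≤m+n x y)))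
bump-unbump-bump (suc j) (y ∷ ys) t≤x = cong (y ∷_) (bump-unbump-bump j ys t≤x)

bump-comm : ∀ i j a b w → bump i a (bump j b w) ≡ bump j b (bump i a w)
bump-comm _       _       _ _ []       = refl
bump-comm zero    zero    a b (y ∷ ys) = cong (_∷ ys) (trans (sym (+-assoc a b y)) (trans (cong (_+ y) (+-comm a b)) (+-assoc b a y)))
bump-comm zero    (suc j) _ _ (_ ∷ _)  = refl
bump-comm (suc i) zero    _ _ (_ ∷ _)  = refl
bump-comm (suc i) (suc j) a b (y ∷ ys) = cong (y ∷_) (bump-comm i j a b ys)

bump-suc : ∀ j x w → bump j (suc x) w ≡ bump j 1 (bump j x w)
bump-suc _       _ []       = refl
bump-suc zero    _ (_ ∷ _)  = refl
bump-suc (suc j) x (y ∷ ys) = cong (y ∷_) (bump-suc j x ys)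

unbump-bump-suc : ∀ j x w → unbump j x (bump j (suc x) w) ≡ bump j 1 w
unbump-bump-suc _       _ []       = refl
unbump-bump-suc zero    x (y ∷ ys) = cong (_∷ ys) (trans (cong (_∸ x) (sym (+-suc x y))) (m+n∸m≡n x (suc y)))
unbump-bump-suc (suc j) x (y ∷ ys) = cong (y ∷_) (unbump-bump-suc j x ys)

bump-injective : ∀ j n {u u'} → bump j n u ≡ bump j n u' → u ≡ u'
bump-injective _       _ {[]}     {[]}       _  = refl
bump-injective zero    _ {[]}     {_ ∷ _}    ()
bump-injective (suc j) _ {[]}     {_ ∷ _}    ()
bump-injective zero    _ {_ ∷ _}  {[]}       ()
bump-injective (suc j) _ {_ ∷ _}  {[]}       ()
bump-injective zero    n {y ∷ ys} {y' ∷ ys'} eq = cong₂ _∷_ (+-cancelˡ-≡ n y y' (∷-injectiveˡ eq)) (∷-injectiveʳ eq)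
bump-injective (suc j) n {y ∷ ys} {y' ∷ ys'} eq = cong₂ _∷_ (∷-injectiveˡ eq) (bump-injective j n (∷-injectiveʳ eq))

self∈steps : ∀ u → u ∈ steps u
self∈steps []      = here refl
self∈steps (x ∷ w) = ∈-++⁺ˡ (∈-map⁺ (x ∷_) (self∈steps w))

bump∈steps : ∀ j u → bump j 1 u ∈ steps u
bump∈steps _       []      = here refl
bump∈steps zero    (x ∷ w) = ∈-++⁺ʳ (map (x ∷_) (steps w)) (here refl)
bump∈steps (suc j) (x ∷ w) = ∈-++⁺ˡ (∈-map⁺ (x ∷_) (bump∈steps j w))

∷-steps : ∀ {x v w} → v ∈ steps w → x ∷ v ∈ steps (x ∷ w)
∷-steps p = ∈-++⁺ˡ (∈-map⁺ _ p)

∈steps⁻ : ∀ {v} u → v ∈ steps u → v ≡ u ⊎ Σ ℕ (λ j → j < length u × v ≡ bump j 1 u)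
∈steps⁻ []      (here refl) = inj₁ refl
∈steps⁻ (x ∷ w) p with ∈-++⁻ (map (x ∷_) (steps w)) p
... | inj₂ (here refl) = inj₂ (0 , s≤s z≤n , refl)
... | inj₁ q with ∈-map⁻ (x ∷_) q
...   | v , v∈ , refl with ∈steps⁻ w v∈
...     | inj₁ refl = inj₁ refl
...     | inj₂ (j , j<len , refl) = inj₂ (suc j , s≤s j<len , refl)

-- In direction 0 the lines are parallel to e₀
-- and the line of z = x ∷ w is labelled by w; in direction j+1 they are
-- parallel to e₀ - e_{j+1} and labelled by bump j x w (the head moved into
-- coordinate j+1).  pointAt d κ t is the point of line κ with head t.
line : ℕ → List ℕ → List ℕ
line _       []      = []
line zero    (_ ∷ w) = w
line (suc j) (x ∷ w) = bump j x w

pointAt : ℕ → List ℕ → ℕ → List ℕ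
pointAt zero    κ t = t ∷ κ
pointAt (suc j) κ t = t ∷ unbump j t κ

lowerOnLine : ℕ → List ℕ → List ℕ
lowerOnLine d z = pointAt d (line d z) (hd z ∸ 1)

-- Raising the head of a point on line κ lands on line nextLine d κ; the point
-- of that line with the same head as z is partner d z, again a unit step of z.
nextLine : ℕ → List ℕ → List ℕ
nextLine zero    κ = κ
nextLine (suc j) κ = bump j 1 κ

partner : ℕ → List ℕ → List ℕ
partner zero    z = z
partner (suc j) z = bump (suc j) 1 z

hd-pointAt : ∀ d κ t → hd (pointAt d κ t) ≡ t
hd-pointAt zero    _ _ = refl
hd-pointAt (suc j) _ _ = refl

length-pointAt : ∀ d κ t → length (pointAt d κ t) ≡ suc (length κ)
length-pointAt zero    _ _ = refl
length-pointAt (suc j) κ t = cong suc (length-unbump j t κ)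

length-line : ∀ d x w → length (line d (x ∷ w)) ≡ length w
length-line zero    _ _ = refl
length-line (suc j) x w = length-bump j x w

IsCons-pointAt : ∀ d κ t → IsCons (pointAt d κ t)
IsCons-pointAt zero    κ t = t , κ , refl
IsCons-pointAt (suc j) κ t = t , unbump j t κ , refl

pointAt-line : ∀ d {z} → IsCons z → pointAt d (line d z) (hd z) ≡ z
pointAt-line zero    (_ , _ , refl) = refl
pointAt-line (suc j) (x , w , refl) = cong (x ∷_) (unbump-bump j x w)

line-pointAt : ∀ d x w t → t ≤ x → line d (pointAt d (line d (x ∷ w)) t) ≡ line d (x ∷ w)
line-pointAt zero    _ _ _ _   = refl
line-pointAt (suc j) _ w _ t≤x = bump-unbump-bump j w t≤x

line-bump : ∀ d j {z} → IsCons z → line d (bump (suc j) 1 z) ≡ bump j 1 (line d z)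
line-bump zero    _ (_ , _ , refl) = refl
line-bump (suc i) j (x , w , refl) = bump-comm i j x 1 w

line-raise : ∀ d {z} → IsCons z → line d (bump 0 1 z) ≡ nextLine d (line d z)
line-raise zero    (_ , _ , refl) = refl
line-raise (suc j) (x , w , refl) = bump-suc j x w

line-partner : ∀ d {z} → IsCons z → line d (partner d z) ≡ nextLine d (line d z)
line-partner zero    (_ , _ , refl) = refl
line-partner (suc j) (x , w , refl) = bump-comm j j x 1 w

hd-raise : ∀ {z} → IsCons z → hd (bump 0 1 z) ≡ suc (hd z)
hd-raise (_ , _ , refl) = refl

hd-partner : ∀ d {z} → IsCons z → hd (partner d z) ≡ hd z
hd-partner zero    _              = refl
hd-partner (suc j) (_ , _ , refl) = refl

partner∈steps : ∀ d z → partner d z ∈ steps z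
partner∈steps zero    z = self∈steps z
partner∈steps (suc j) z = bump∈steps (suc j) z

partner-injective : ∀ d {z z'} → partner d z ≡ partner d z' → z ≡ z'
partner-injective zero    eq = eq
partner-injective (suc j) eq = bump-injective (suc j) 1 eq

lowerOnLine-diagonal : ∀ j x w → lowerOnLine (suc j) (suc x ∷ w) ≡ x ∷ bump j 1 w
lowerOnLine-diagonal j x w = cong (x ∷_) (unbump-bump-suc j x w)

-- Compressions

_≟v_ : DecidableEquality (List ℕ)
_≟v_ = ≡-dec _≟_

weight : List (List ℕ) → ℕ
weight X = sum (map hd X)

ContainsSteps : List (List ℕ) → List (List ℕ) → Set
ContainsSteps F L = ∀ {u v} → u ∈ F → v ∈ steps u → v ∈ L

-- Compression in direction d replaces the points of X on each line by the
-- same number of points of that line with heads 0, 1, 2, ….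
module Compression (d : ℕ) where
  open Fibres _≟v_ (line d) public

  fibreSize : List ℕ → List (List ℕ) → ℕ
  fibreSize κ X = length (fibre κ X)

  lines : List (List ℕ) → List (List ℕ)
  lines X = deduplicate _≟v_ (map (line d) X)

  initialSegment : List (List ℕ) → List ℕ → List (List ℕ)
  initialSegment X κ = map (pointAt d κ) (downFrom (fibreSize κ X))

  compress : List (List ℕ) → List (List ℕ)
  compress X = concatMap (initialSegment X) (lines X)

  ∈fibre⁺ : ∀ {X z κ} → z ∈ X → line d z ≡ κ → z ∈ fibre κ X
  ∈fibre⁺ = ∈-filter⁺ (λ z → line d z ≟v _)

  ∈fibre⁻ : ∀ {X z κ} → z ∈ fibre κ X → z ∈ X × line d z ≡ κ
  ∈fibre⁻ {X} = ∈-filter⁻ (λ z → line d z ≟v _) {xs = X}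

  fibre-unique : ∀ {X} κ → Unique X → Unique (fibre κ X)
  fibre-unique κ = filter⁺ (λ z → line d z ≟v κ)

  ∈lines : ∀ {X z} → z ∈ X → line d z ∈ lines X
  ∈lines p = ∈-deduplicate⁺ _≟v_ (∈-map⁺ (line d) p)

  -- Points of one line are told apart by their heads.
  heads-unique : ∀ {X} κ → Unique X → All IsCons X → Unique (map hd (fibre κ X))
  heads-unique {X} κ u isCons = map-unique-on hd (fibre-unique κ u) same-head⇒same
    where
      same-head⇒same : ∀ {a b} → a ∈ fibre κ X → b ∈ fibre κ X → hd a ≡ hd b → a ≡ b
      same-head⇒same pa pb hd≡ =
        let (a∈ , la) = ∈fibre⁻ pa
            (b∈ , lb) = ∈fibre⁻ pb
        in trans (sym (pointAt-line d (All.lookup isCons a∈)))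
                 (trans (cong₂ (pointAt d) (trans la (sym lb)) hd≡) (pointAt-line d (All.lookup isCons b∈)))

  -- If X has more than t points on line κ, the point with head t lies on κ:
  -- some point of X on κ has head ≥ t, and moving down a line stays on it.
  pointAt-onLine : ∀ {X} → Unique X → All IsCons X → ∀ κ t → t < fibreSize κ X → line d (pointAt d κ t) ≡ κ
  pointAt-onLine {X} u isCons κ t t<size
    with unique⇒large (heads-unique κ u isCons) (subst (t <_) (sym (length-map hd (fibre κ X))) t<size)
  ... | q , q∈ , t≤q with ∈-map⁻ hd q∈
  ...   | z , z∈ , refl with ∈fibre⁻ {X} z∈
  ...     | z∈X , refl with All.lookup isCons z∈X
  ...       | x , w , refl = line-pointAt d x w t t≤q

  ∈compress⁻ : ∀ {X z} → Unique X → All IsCons X → z ∈ compress X → IsCons z × hd z < fibreSize (line d z) X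
  ∈compress⁻ {X} u isCons p with ∈-concat⁻′ (map (initialSegment X) (lines X)) p
  ... | _ , z∈seg , seg∈ with ∈-map⁻ (initialSegment X) seg∈
  ...   | κ , _ , refl with ∈-map⁻ (pointAt d κ) z∈seg
  ...     | t , t∈ , refl =
    IsCons-pointAt d κ t ,
    subst₂ (λ h l → h < fibreSize l X) (sym (hd-pointAt d κ t)) (sym (pointAt-onLine u isCons κ t (∈-downFrom⁻ t∈))) (∈-downFrom⁻ t∈)

  ∈compress⁺ : ∀ {X z} → IsCons z → hd z < fibreSize (line d z) X → z ∈ compress X
  ∈compress⁺ {X} {z} z-cons hd<size =
    let (y , y∈) = nonEmpty (fibre (line d z) X) hd<size
        (y∈X , ly) = ∈fibre⁻ y∈
        z∈seg : z ∈ initialSegment X (line d z)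
        z∈seg = subst (_∈ initialSegment X (line d z)) (pointAt-line d z-cons) (∈-map⁺ (pointAt d (line d z)) (∈-downFrom⁺ hd<size))
    in ∈-concat⁺′ z∈seg (∈-map⁺ (initialSegment X) (subst (_∈ lines X) ly (∈lines y∈X)))
    where
      nonEmpty : ∀ {A : Set} (xs : List A) {n} → n < length xs → Σ A (_∈ xs)
      nonEmpty (x ∷ _) _ = x , here refl

  length-compress : ∀ X → length (compress X) ≡ length X
  length-compress X = begin
    length (compress X)                                         ≡⟨ length≡sum-ones (compress X) ⟩
    sum (map one (compress X))                                  ≡⟨ sum-map-concat one (map (initialSegment X) (lines X)) ⟩
    sum (map (λ s → sum (map one s)) (map (initialSegment X) (lines X)))
                                                                ≡⟨ cong sum (map-∘ (lines X)) ⟨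
    sum (map (λ κ → sum (map one (initialSegment X κ))) (lines X))
                                                                ≡⟨ cong sum (map-cong segment≡fibre (lines X)) ⟩
    sum (map (λ κ → sum (map one (fibre κ X))) (lines X))       ≡⟨ sum-fibres one (lines X) (deduplicate-! _) X ∈lines ⟨
    sum (map one X)                                             ≡⟨ length≡sum-ones X ⟨
    length X                                                    ∎
    where
      open ≡-Reasoning
      one : List ℕ → ℕ
      one _ = 1
      segment≡fibre : ∀ κ → sum (map one (initialSegment X κ)) ≡ sum (map one (fibre κ X))
      segment≡fibre κ = begin
        sum (map one (initialSegment X κ))   ≡⟨ length≡sum-ones (initialSegment X κ) ⟨
        length (initialSegment X κ)          ≡⟨ length-map (pointAt d κ) (downFrom (fibreSize κ X)) ⟩
        length (downFrom (fibreSize κ X))    ≡⟨ length-downFrom (fibreSize κ X) ⟩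
        fibreSize κ X                        ≡⟨ length≡sum-ones (fibre κ X) ⟩
        sum (map one (fibre κ X))            ∎

  compress-unique : ∀ {X} → Unique X → All IsCons X → Unique (compress X)
  compress-unique {X} u isCons =
    concatMap-unique (line d) (initialSegment X) (lines X) (deduplicate-! _) segment-unique onLine
    where
      segment-unique : ∀ {κ} → κ ∈ lines X → Unique (initialSegment X κ)
      segment-unique {κ} _ =
        map⁺ (λ {a} {b} eq → trans (sym (hd-pointAt d κ a)) (trans (cong hd eq) (hd-pointAt d κ b))) (downFrom⁺ _)
      onLine : ∀ {κ z} → κ ∈ lines X → z ∈ initialSegment X κ → line d z ≡ κ
      onLine {κ} _ z∈ with ∈-map⁻ (pointAt d κ) z∈
      ... | t , t∈ , refl = pointAt-onLine u isCons κ t (∈-downFrom⁻ t∈)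

  compress-lengths : ∀ {X e} → All (λ z → length z ≡ suc e) X → All (λ z → length z ≡ suc e) (compress X)
  compress-lengths {X} {e} lengths = All.tabulate length≡
    where
      length≡ : ∀ {z} → z ∈ compress X → length z ≡ suc e
      length≡ p with ∈-concat⁻′ (map (initialSegment X) (lines X)) p
      ... | _ , z∈seg , seg∈ with ∈-map⁻ (initialSegment X) seg∈
      ...   | κ , κ∈ , refl with ∈-map⁻ (pointAt d κ) z∈seg | ∈-map⁻ (line d) (∈-deduplicate⁻ _≟v_ (map (line d) X) κ∈)
      ...     | t , _ , refl | z' , z'∈ , refl with z' | All.lookup lengths z'∈
      ...       | x ∷ w | len≡ = trans (length-pointAt d (line d (x ∷ w)) t) (cong suc (trans (length-line d x w) (suc-injective len≡)))

  weight-compress : ∀ X → weight (compress X) ≡ sum (map (λ κ → triangle (fibreSize κ X)) (lines X))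
  weight-compress X =
    trans (sum-map-concat hd (map (initialSegment X) (lines X)))
          (cong sum (trans (sym (map-∘ (lines X))) (map-cong (λ κ → cong sum (heads-segment κ (downFrom (fibreSize κ X)))) (lines X))))
    where
      heads-segment : ∀ κ ts → map hd (map (pointAt d κ) ts) ≡ ts
      heads-segment κ []       = refl
      heads-segment κ (t ∷ ts) = cong₂ _∷_ (hd-pointAt d κ t) (heads-segment κ ts)

  -- On each line the original points have distinct heads, hence weigh at least as much.
  triangle≤fibreWeight : ∀ {X} → Unique X → All IsCons X → ∀ κ → triangle (fibreSize κ X) ≤ weight (fibre κ X)
  triangle≤fibreWeight {X} u isCons κ =
    triangle≤sum (fibreSize κ X) (map hd (fibre κ X)) (length-map hd (fibre κ X)) (heads-unique κ u isCons)

  -- If some z₀ ∈ X has no point of X right below it on its line, then the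
  -- heads on that line are not an initial segment and compression strictly
  -- decreases the weight.
  compress-lighter : ∀ {X z₀} → Unique X → All IsCons X → z₀ ∈ X → lowerOnLine d z₀ ∉ X →
                     weight (compress X) < weight X
  compress-lighter {X} {z₀} u isCons z₀∈ below∉ =
    subst₂ _<_ (sym (weight-compress X)) (sym (sum-fibres hd (lines X) (deduplicate-! _) X ∈lines))
      (sum-map-mono-< _ _ (lines X) (λ {κ} _ → triangle≤fibreWeight u isCons κ) (∈lines z₀∈) strict)
    where
      κ₀ : List ℕ
      κ₀ = line d z₀
      heads : List ℕ
      heads = map hd (fibre κ₀ X)
      below∉heads : hd z₀ ∸ 1 ∉ heads
      below∉heads p with ∈-map⁻ hd p
      ... | y , y∈ , hd≡ with ∈fibre⁻ {X} y∈
      ...   | y∈X , line≡ = below∉ (subst (_∈ X) (trans (sym (pointAt-line d (All.lookup isCons y∈X))) (cong₂ (pointAt d) line≡ (sym hd≡))) y∈X)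
      strict : triangle (fibreSize κ₀ X) < weight (fibre κ₀ X)
      strict with gap⇒large (heads-unique κ₀ u isCons) (∈-map⁺ hd (∈fibre⁺ z₀∈ refl)) below∉heads
      ... | q , q∈ , len≤q =
        triangle<sum (fibreSize κ₀ X) heads (length-map hd (fibre κ₀ X)) (heads-unique κ₀ u isCons) q∈
                     (subst (_≤ q) (length-map hd (fibre κ₀ X)) len≤q)

  fibreSize-mono : ∀ {F L} κ → Unique F → F ⊆ L → fibreSize κ F ≤ fibreSize κ L
  fibreSize-mono {F} κ u F⊆L =
    unique-⊆⇒length≤ (fibre-unique κ u) (λ p → let (y∈F , line≡) = ∈fibre⁻ {F} p in ∈fibre⁺ (F⊆L y∈F) line≡)

  -- Raising coordinate j+1 maps the points of F on line κ injectively to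
  -- points of L on line bump j 1 κ.
  fibreSize-bump : ∀ {F L} → Unique F → All IsCons F → ContainsSteps F L → ∀ j κ →
                   fibreSize κ F ≤ fibreSize (bump j 1 κ) L
  fibreSize-bump {F} {L} u isCons steps⊆L j κ =
    subst (_≤ fibreSize (bump j 1 κ) L) (length-map _ (fibre κ F))
      (unique-⊆⇒length≤ (map⁺ (bump-injective (suc j) 1) (fibre-unique κ u)) image⊆)
    where
      image⊆ : map (bump (suc j) 1) (fibre κ F) ⊆ fibre (bump j 1 κ) L
      image⊆ q with ∈-map⁻ (bump (suc j) 1) q
      ... | y , y∈ , refl =
        let (y∈F , line≡) = ∈fibre⁻ {F} y∈
        in ∈fibre⁺ (steps⊆L y∈F (bump∈steps (suc j) y)) (trans (line-bump d j (All.lookup isCons y∈F)) (cong (bump j 1) line≡))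

  -- On line nextLine d κ, L contains the partners of all points of F on κ
  -- and, above all of them, the raise of the highest one.
  fibreSize-next : ∀ {F L} → Unique F → All IsCons F → ContainsSteps F L → ∀ κ → 0 < fibreSize κ F →
                   suc (fibreSize κ F) ≤ fibreSize (nextLine d κ) L
  fibreSize-next {F} {L} u isCons steps⊆L κ nonempty =
    subst (_≤ fibreSize (nextLine d κ) L) (cong suc (length-map (partner d) (fibre κ F)))
      (unique-⊆⇒length≤ (raise-new ∷ map⁺ (partner-injective d) (fibre-unique κ u)) ⊆fibre)
    where
      highest : Σ (List ℕ) λ m → m ∈ fibre κ F × (∀ {y} → y ∈ fibre κ F → hd y ≤ hd m)
      highest = maximiser hd (fibre κ F) nonempty
      top : List ℕ
      top = proj₁ highest
      top∈F : top ∈ F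
      top∈F = proj₁ (∈fibre⁻ {F} (proj₁ (proj₂ highest)))
      top-line : line d top ≡ κ
      top-line = proj₂ (∈fibre⁻ {F} (proj₁ (proj₂ highest)))
      top-highest : ∀ {y} → y ∈ fibre κ F → hd y ≤ hd top
      top-highest = proj₂ (proj₂ highest)

      raise-new : All (bump 0 1 top ≢_) (map (partner d) (fibre κ F))
      raise-new = All.tabulate λ q raise≡ → case ∈-map⁻ (partner d) q of λ where
        (y , y∈ , refl) → <-irrefl refl (subst (_≤ hd top)
          (trans (sym (hd-partner d (All.lookup isCons (proj₁ (∈fibre⁻ {F} y∈)))))
                 (trans (cong hd (sym raise≡)) (hd-raise (All.lookup isCons top∈F))))
          (top-highest y∈))

      ⊆fibre : bump 0 1 top ∷ map (partner d) (fibre κ F) ⊆ fibre (nextLine d κ) L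
      ⊆fibre (here refl) =
        ∈fibre⁺ (steps⊆L top∈F (bump∈steps 0 top)) (trans (line-raise d (All.lookup isCons top∈F)) (cong (nextLine d) top-line))
      ⊆fibre (there q) with ∈-map⁻ (partner d) q
      ... | y , y∈ , refl =
        let (y∈F , line≡) = ∈fibre⁻ {F} y∈
        in ∈fibre⁺ (steps⊆L y∈F (partner∈steps d y)) (trans (line-partner d (All.lookup isCons y∈F)) (cong (nextLine d) line≡))

  compress-steps : ∀ {F L} → Unique F → All IsCons F → ContainsSteps F L → ContainsSteps (compress F) (compress L)
  compress-steps {F} {L} u isCons steps⊆L z∈ v∈ with ∈compress⁻ u isCons z∈
  ... | (x , w , refl) , hd<size with ∈steps⁻ (x ∷ w) v∈
  ...   | inj₁ refl =
    ∈compress⁺ {L} (x , w , refl) (<-≤-trans hd<size (fibreSize-mono _ u (λ y∈ → steps⊆L y∈ (self∈steps _))))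
  ...   | inj₂ (zero , _ , refl) =
    ∈compress⁺ {L} (suc x , w , refl)
      (subst (λ l → suc x < fibreSize l L) (sym (line-raise d (x , w , refl)))
        (<-≤-trans (s≤s hd<size) (fibreSize-next u isCons steps⊆L (line d (x ∷ w)) (≤-<-trans z≤n hd<size))))
  ...   | inj₂ (suc j , _ , refl) =
    ∈compress⁺ {L} (x , bump j 1 w , refl)
      (subst (λ l → x < fibreSize l L) (sym (line-bump d j (x , w , refl)))
        (<-≤-trans hd<size (fibreSize-bump u isCons steps⊆L j (line d (x ∷ w)))))

Family : ℕ → List (List ℕ) → Set
Family E F = Unique F × All (λ z → length z ≡ E) F

lengths⇒IsCons : ∀ {e F} → All (λ z → length z ≡ suc e) F → All IsCons F
lengths⇒IsCons []                                 = []
lengths⇒IsCons {F = (x ∷ w) ∷ _} (_ ∷ lengths) = (x , w , refl) ∷ lengths⇒IsCons lengths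

shadow : List (List ℕ) → List (List ℕ)
shadow F = deduplicate _≟v_ (concatMap steps F)

shadow-unique : ∀ F → Unique (shadow F)
shadow-unique F = deduplicate-! _

shadow-contains : ∀ F → ContainsSteps F (shadow F)
shadow-contains F u∈ v∈ = ∈-deduplicate⁺ _≟v_ (∈-concat⁺′ v∈ (∈-map⁺ steps u∈))

∈shadow⁻ : ∀ {F v} → v ∈ shadow F → Σ (List ℕ) λ u → u ∈ F × v ∈ steps u
∈shadow⁻ {F} p with ∈-concat⁻′ (map steps F) (∈-deduplicate⁻ _≟v_ (concatMap steps F) p)
... | _ , v∈ , steps∈ with ∈-map⁻ steps steps∈
...   | u , u∈ , refl = u , u∈ , v∈

MacaulayBound : ℕ → Set
MacaulayBound E = ∀ F L as → Family E F → Unique L → ContainsSteps F L → BinRep E as → binSum E as ≤ length F →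
                  length F + incSum E as ≤ length L + binSum E as

-- In dimension 0, Inc^[0](m) = m and F ⊆ L.
macaulay₀ : MacaulayBound 0
macaulay₀ F L as (u , _) _ steps⊆L r _ =
  subst (λ i → length F + i ≤ length L + binSum 0 as) (sym (incSum₀ r))
    (+-monoˡ-≤ (binSum 0 as) (unique-⊆⇒length≤ u (λ z∈ → steps⊆L z∈ (self∈steps _))))

-- F is compressed in directions 0, …, e: one step down from any point of F,
-- along any of its lines, is again a point of F (for points of head 0 this
-- step is the point itself).
Compressed : ℕ → List (List ℕ) → Set
Compressed e F = All (λ z → All (λ d → lowerOnLine d z ∈ F) (downFrom (suc e))) F

compressed? : ∀ e F → Dec (Compressed e F)
compressed? e F = all? (λ z → all? (λ d → lowerOnLine d z ∈? F) (downFrom (suc e))) F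

uncompressed-witness : ∀ {e F} → ¬ Compressed e F → Σ (List ℕ) λ z → Σ ℕ λ d → z ∈ F × lowerOnLine d z ∉ F
uncompressed-witness {e} {F} not-compressed
  with find (¬All⇒Any¬ (λ z → all? (λ d → lowerOnLine d z ∈? F) (downFrom (suc e))) F not-compressed)
... | z , z∈ , not-all with find (¬All⇒Any¬ (λ d → lowerOnLine d z ∈? F) (downFrom (suc e)) not-all)
...   | d , _ , below∉ = z , d , z∈ , below∉

lowerOnLine∈ : ∀ {e F z} d → Compressed e F → z ∈ F → d < suc e → lowerOnLine d z ∈ F
lowerOnLine∈ d compressed z∈ d<1+e = All.lookup (All.lookup compressed z∈) (∈-downFrom⁺ d<1+e)

lowerHead : List ℕ → List ℕ
lowerHead []      = []
lowerHead (x ∷ w) = pred x ∷ w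

weight-lowerHead : ∀ (Y : List (List ℕ)) → All (λ z → ¬ hd z ≡ 0) Y → All IsCons Y →
                   length (map lowerHead Y) + weight (map lowerHead Y) ≡ weight Y
weight-lowerHead []                     _              _ = refl
weight-lowerHead ([] ∷ _)               _              ((_ , _ , ()) ∷ _)
weight-lowerHead ((zero ∷ _) ∷ _)       (nonzero ∷ _) _ = ⊥-elim (nonzero refl)
weight-lowerHead ((suc x ∷ w) ∷ Y)      (_ ∷ nonzero) (_ ∷ isCons) =
  trans (regroup (length (map lowerHead Y)) x (weight (map lowerHead Y)))
        (cong (suc x +_) (weight-lowerHead Y nonzero isCons))
  where
    regroup : ∀ l x m → suc l + (x + m) ≡ suc x + (l + m)
    regroup = solve-∀

filter-split : {A : Set} {P : A → Set} (P? : ∀ x → Dec (P x)) (xs : List A) →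
               length (filter P? xs) + length (filter (λ x → ¬? (P? x)) xs) ≡ length xs
filter-split P? []       = refl
filter-split P? (x ∷ xs) with P? x
... | yes _ = cong suc (filter-split P? xs)
... | no  _ = trans (+-suc _ _) (cong suc (filter-split P? xs))

sum-filter-≤ : {A : Set} {P : A → Set} (P? : ∀ x → Dec (P x)) (g : A → ℕ) (xs : List A) →
               sum (map g (filter P? xs)) ≤ sum (map g xs)
sum-filter-≤ P? g []       = z≤n
sum-filter-≤ P? g (x ∷ xs) with does (P? x)
... | true  = +-monoʳ-≤ (g x) (sum-filter-≤ P? g xs)
... | false = ≤-trans (sum-filter-≤ P? g xs) (m≤n+m _ (g x))

-- For a family F in ℕ^(e+1): W collects the tails of the members with head 0
-- (a family in ℕ^e), G the members with positive head, lowered by one.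
module Layers (e : ℕ) (F : List (List ℕ)) (u : Unique F) (lengths : All (λ z → length z ≡ suc e) F) where
  private
    isCons : All IsCons F
    isCons = lengths⇒IsCons lengths
    atZero? : ∀ z → Dec (hd z ≡ 0)
    atZero? z = hd z ≟ 0
    bottom : List (List ℕ)
    bottom = filter atZero? F
    above : List (List ℕ)
    above = filter (λ z → ¬? (atZero? z)) F

    ∈bottom⁻ : ∀ {z} → z ∈ bottom → Σ (List ℕ) λ w → z ≡ 0 ∷ w × z ∈ F
    ∈bottom⁻ p with ∈-filter⁻ atZero? {xs = F} p
    ... | z∈F , hd≡0 with All.lookup isCons z∈F
    ...   | x , w , refl with hd≡0
    ...     | refl = w , refl , z∈F

    ∈above⁻ : ∀ {z} → z ∈ above → Σ ℕ λ x → Σ (List ℕ) λ w → z ≡ suc x ∷ w × z ∈ F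
    ∈above⁻ p with ∈-filter⁻ (λ z → ¬? (atZero? z)) {xs = F} p
    ... | z∈F , hd≢0 with All.lookup isCons z∈F
    ...   | zero  , w , refl = ⊥-elim (hd≢0 refl)
    ...   | suc x , w , refl = x , w , refl , z∈F

  W : List (List ℕ)
  W = map tl bottom

  G : List (List ℕ)
  G = map lowerHead above

  length-layers : length F ≡ length W + length G
  length-layers = trans (sym (filter-split atZero? F)) (sym (cong₂ _+_ (length-map tl bottom) (length-map lowerHead above)))

  ∈W⁻ : ∀ {w} → w ∈ W → 0 ∷ w ∈ F
  ∈W⁻ p with ∈-map⁻ tl p
  ... | z , z∈ , refl with ∈bottom⁻ z∈
  ...   | w , refl , z∈F = z∈F

  ∈G⁻ : ∀ {g} → g ∈ G → Σ ℕ λ x → Σ (List ℕ) λ w → g ≡ x ∷ w × suc x ∷ w ∈ F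
  ∈G⁻ p with ∈-map⁻ lowerHead p
  ... | z , z∈ , refl with ∈above⁻ z∈
  ...   | x , w , refl , z∈F = x , w , refl , z∈F

  W-family : Family e W
  W-family = map-unique-on tl (filter⁺ atZero? u) tl-injective , All.tabulate (λ p → suc-injective (All.lookup lengths (∈W⁻ p)))
    where
      tl-injective : ∀ {a b} → a ∈ bottom → b ∈ bottom → tl a ≡ tl b → a ≡ b
      tl-injective pa pb eq with ∈bottom⁻ pa | ∈bottom⁻ pb
      ... | _ , refl , _ | _ , refl , _ = cong (0 ∷_) eq

  G-family : Family (suc e) G
  G-family = map-unique-on lowerHead (filter⁺ (λ z → ¬? (atZero? z)) u) lowerHead-injective , All.tabulate length≡
    where
      lowerHead-injective : ∀ {a b} → a ∈ above → b ∈ above → lowerHead a ≡ lowerHead b → a ≡ b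
      lowerHead-injective pa pb eq with ∈above⁻ pa | ∈above⁻ pb
      ... | _ , _ , refl , _ | _ , _ , refl , _ = cong₂ (λ x w → suc x ∷ w) (cong hd eq) (cong tl eq)
      length≡ : ∀ {g} → g ∈ G → length g ≡ suc e
      length≡ p with ∈G⁻ p
      ... | _ , _ , refl , z∈F = All.lookup lengths z∈F

  G-lighter : length G + weight G ≤ weight F
  G-lighter = ≤-trans (≤-reflexive (weight-lowerHead above (all-filter (λ z → ¬? (atZero? z)) F) (All.tabulate (λ p → All.lookup isCons (proj₁ (∈-filter⁻ (λ z → ¬? (atZero? z)) {xs = F} p))))))
                      (sum-filter-≤ (λ z → ¬? (atZero? z)) hd F)

  -- L contains the vectors 0 ∷ v for v in the shadow of W, and the raises
  -- z + e₀ of the members of F; these have head 0 resp. positive head.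
  shadowW+F≤ : ∀ {L} → ContainsSteps F L → length (shadow W) + length F ≤ length L
  shadowW+F≤ {L} steps⊆L =
    subst (_≤ length L) (trans (length-++ (map (0 ∷_) (shadow W))) (cong₂ _+_ (length-map _ (shadow W)) (length-map _ F)))
      (unique-⊆⇒length≤ (++⁺ (map⁺ ∷-injectiveʳ (shadow-unique W)) (map⁺ (bump-injective 0 1) u) disjoint) ⊆L)
    where
      disjoint : ∀ {v} → v ∈ map (0 ∷_) (shadow W) × v ∈ map (bump 0 1) F → ⊥
      disjoint (p , q) with ∈-map⁻ (0 ∷_) p | ∈-map⁻ (bump 0 1) q
      ... | _ , _ , refl | z , z∈ , eq with All.lookup isCons z∈
      ...   | _ , _ , refl with () ← eq

      ⊆L : map (0 ∷_) (shadow W) ++ map (bump 0 1) F ⊆ L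
      ⊆L p with ∈-++⁻ (map (0 ∷_) (shadow W)) p
      ... | inj₁ q with ∈-map⁻ (0 ∷_) q
      ...   | v , v∈ , refl with ∈shadow⁻ v∈
      ...     | w , w∈ , v∈steps = steps⊆L (∈W⁻ w∈) (∷-steps v∈steps)
      ⊆L p | inj₂ q with ∈-map⁻ (bump 0 1) q
      ...   | z , z∈ , refl = steps⊆L z∈ (bump∈steps 0 z)

  -- If F is compressed, every unit step of a member of G lies in F:
  -- (x ∷ w) + e₀ = (x+1) ∷ w ∈ F, and (x ∷ w) + e_{j+1} lies one step below
  -- (x+1) ∷ w on a line of direction j+1.
  G-steps⊆F : Compressed e F → ContainsSteps G F
  G-steps⊆F compressed g∈ v∈ with ∈G⁻ g∈
  ... | x , w , refl , z∈F with ∈steps⁻ (x ∷ w) v∈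
  ...   | inj₁ refl              = lowerOnLine∈ 0 compressed z∈F (s≤s z≤n)
  ...   | inj₂ (zero , _ , refl) = z∈F
  ...   | inj₂ (suc j , j<len , refl) =
    subst (_∈ F) (lowerOnLine-diagonal j x w) (lowerOnLine∈ (suc j) compressed z∈F (s≤s j<e))
    where
      j<e : j < e
      j<e = subst (j <_) (suc-injective (All.lookup lengths z∈F)) (≤-pred j<len)

  length-shadowG≤F : Compressed e F → length (shadow G) ≤ length F
  length-shadowG≤F compressed = unique-⊆⇒length≤ (shadow-unique G) λ v∈ →
    let (g , g∈ , v∈steps) = ∈shadow⁻ v∈ in G-steps⊆F compressed g∈ v∈steps

-- Arithmetic of the compressed case.  With a = |W|, b = |G| and m = S split
-- by Pascal's rule into a lower part A (with Inc-value Ie) and an upper part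
-- Sb (with Inc-value Ib):

-- if A ≤ a, the bound for W in dimension e gives the bound for F;
bound-from-W : ∀ {f l lw a A s ie} → a + ie ≤ lw + A → A ≤ a → lw + f ≤ l → f + (s + ie) ≤ l + s
bound-from-W {f} {l} {lw} {a} {A} {s} {ie} boundW A≤a lw+f≤l = begin
  f + (s + ie)  ≤⟨ +-monoʳ-≤ f (+-monoʳ-≤ s ie≤lw) ⟩
  f + (s + lw)  ≡⟨ regroup f s lw ⟩
  lw + f + s    ≤⟨ +-monoˡ-≤ s lw+f≤l ⟩
  l + s         ∎
  where
    open ≤-Reasoning
    regroup : ∀ f s lw → f + (s + lw) ≡ lw + f + s
    regroup = solve-∀
    ie≤lw : ie ≤ lw
    ie≤lw = +-cancelˡ-≤ a ie lw (≤-trans boundW (subst (lw + A ≤_) (+-comm lw a) (+-monoʳ-≤ lw A≤a)))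

-- if a < A, the upper part fits into G, so the bound applies to G ...
upperSum≤b : ∀ {a b A S Sb} → Sb + A ≤ S + 1 → S ≤ a + b → a < A → Sb ≤ b
upperSum≤b {a} {b} {A} {S} {Sb} split S≤a+b a<A = +-cancelʳ-≤ (a + 1) Sb b (begin
  Sb + (a + 1)  ≤⟨ +-monoʳ-≤ Sb (subst (_≤ A) (+-comm 1 a) a<A) ⟩
  Sb + A        ≤⟨ split ⟩
  S + 1         ≤⟨ +-monoˡ-≤ 1 S≤a+b ⟩
  a + b + 1     ≡⟨ regroup a b ⟩
  b + (a + 1)   ∎)
  where
    open ≤-Reasoning
    regroup : ∀ a b → a + b + 1 ≡ b + (a + 1)
    regroup = solve-∀

-- ... and the bound for G forces A ≤ a after all.
A≤a-from-G : ∀ {a b A Sb Ib lg} → Sb + A ≤ Ib → b + Ib ≤ lg + Sb → lg ≤ a + b → A ≤ a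
A≤a-from-G {a} {b} {A} {Sb} {Ib} {lg} split boundG lg≤a+b =
  +-cancelʳ-≤ b A a (subst (_≤ a + b) (+-comm b A) (+-cancelˡ-≤ Sb (b + A) (a + b) (begin
    Sb + (b + A)  ≡⟨ x+[y+z]≡y+[x+z] Sb b A ⟩
    b + (Sb + A)  ≤⟨ +-monoʳ-≤ b split ⟩
    b + Ib        ≤⟨ boundG ⟩
    lg + Sb       ≤⟨ +-monoˡ-≤ Sb lg≤a+b ⟩
    a + b + Sb    ≡⟨ +-comm (a + b) Sb ⟩
    Sb + (a + b)  ∎)))
  where
    open ≤-Reasoning
    x+[y+z]≡y+[x+z] : ∀ x y z → x + (y + z) ≡ y + (x + z)
    x+[y+z]≡y+[x+z] = solve-∀

-- The Macaulay-type bound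

BoundBelow : ℕ → ℕ → Set
BoundBelow e N = ∀ F L as → length F + weight F < N → Family (suc e) F → Unique L → ContainsSteps F L →
                 BinRep (suc e) as → binSum (suc e) as ≤ length F → length F + incSum (suc e) as ≤ length L + binSum (suc e) as

module MacaulayStep (e : ℕ) (macaulay-e : MacaulayBound e) where

  -- An uncompressed family is replaced by its compression, which has the
  -- same size, a smaller measure, and a shadow no larger than L.
  uncompressed-case : ∀ N → BoundBelow e N → ∀ F L as → length F + weight F ≤ N → Family (suc e) F → Unique L → ContainsSteps F L →
                      BinRep (suc e) as → binSum (suc e) as ≤ length F → ∀ {z₀} d → z₀ ∈ F → lowerOnLine d z₀ ∉ F →
                      length F + incSum (suc e) as ≤ length L + binSum (suc e) as
  uncompressed-case N below F L as measure≤N (u , lengths) _ steps⊆L r m≤|F| d z₀∈ below∉ =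
    subst (λ n → n + incSum (suc e) as ≤ length L + binSum (suc e) as) (length-compress F)
      (≤-trans boundF' (+-monoˡ-≤ (binSum (suc e) as) shadowF'≤L))
    where
      open Compression d
      isCons : All IsCons F
      isCons = lengths⇒IsCons lengths
      F' : List (List ℕ)
      F' = compress F

      measure' : length F' + weight F' < N
      measure' = <-≤-trans (subst (λ n → n + weight F' < length F + weight F) (sym (length-compress F))
                              (+-monoʳ-< (length F) (compress-lighter u isCons z₀∈ below∉)))
                           measure≤N

      boundF' : length F' + incSum (suc e) as ≤ length (shadow F') + binSum (suc e) as
      boundF' = below F' (shadow F') as measure' (compress-unique u isCons , compress-lengths lengths)
                      (shadow-unique F') (shadow-contains F') r (subst (binSum (suc e) as ≤_) (sym (length-compress F)) m≤|F|)

      shadowF'≤L : length (shadow F') ≤ length L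
      shadowF'≤L = subst (length (shadow F') ≤_) (length-compress L)
        (unique-⊆⇒length≤ (shadow-unique F') λ v∈ →
          let (z , z∈ , v∈steps) = ∈shadow⁻ v∈ in compress-steps u isCons steps⊆L z∈ v∈steps)

  -- A compressed family is split into the layers W and G; Pascal's rule
  -- splits m accordingly, and the bounds for W (dimension e) and G (smaller
  -- measure) combine to the bound for F.
  compressed-case : ∀ N → BoundBelow e N → ∀ F L as → length F + weight F ≤ N → Family (suc e) F → Unique L → ContainsSteps F L →
                    BinRep (suc e) as → binSum (suc e) as ≤ length F → Compressed e F → 1 ≤ length F →
                    length F + incSum (suc e) as ≤ length L + binSum (suc e) as
  compressed-case N below F L as measure≤N (u , lengths) _ steps⊆L r m≤|F| compressed nonempty =
    subst (λ i → length F + i ≤ length L + binSum (suc e) as) (sym (incSum-pascal (suc e) r))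
      (bound-from-W (boundW A≤a) A≤a (shadowW+F≤ steps⊆L))
    where
      open Layers e F u lengths
      A : ℕ
      A = binSum e (lower (suc e) as)
      m≤a+b : binSum (suc e) as ≤ length W + length G
      m≤a+b = subst (binSum (suc e) as ≤_) length-layers m≤|F|

      boundW : A ≤ length W → length W + incSum e (lower (suc e) as) ≤ length (shadow W) + A
      boundW = macaulay-e W (shadow W) (lower (suc e) as) W-family (shadow-unique W) (shadow-contains W) (lower-BinRep r)

      G-measure : length G + weight G < N
      G-measure = <-≤-trans (≤-<-trans G-lighter (m<n+m (weight F) nonempty)) measure≤N

      A≤a : A ≤ length W
      A≤a with A ≤? length W
      ... | yes A≤a = A≤a
      ... | no  A≰a =
        A≤a-from-G (upper+lower≤incSum (suc e) r)
          (below G (shadow G) (upper (suc e) as) G-measure G-family (shadow-unique G) (shadow-contains G) (upper-BinRep (suc e) r)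
                 (upperSum≤b (upper+lower≤binSum+1 (suc e) r) m≤a+b (≰⇒> A≰a)))
          (≤-trans (length-shadowG≤F compressed) (≤-reflexive length-layers))

  bound-below : ∀ N → BoundBelow e N
  bound-below (suc N) [] L as _ _ _ _ r m≤0 =
    subst (_≤ length L + binSum (suc e) as) (sym (binSum≤0⇒incSum≡0 (suc e) r m≤0)) z≤n
  bound-below (suc N) F@(_ ∷ _) L as measure< fam uL steps⊆L r m≤|F| with compressed? e F
  ... | yes compressed = compressed-case N (bound-below N) F L as (≤-pred measure<) fam uL steps⊆L r m≤|F| compressed (s≤s z≤n)
  ... | no  not-compressed =
    let (z₀ , d , z₀∈ , below∉) = uncompressed-witness not-compressed
    in uncompressed-case N (bound-below N) F L as (≤-pred measure<) fam uL steps⊆L r m≤|F| d z₀∈ below∉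

  macaulay-suc : MacaulayBound (suc e)
  macaulay-suc F L as = bound-below (suc (length F + weight F)) F L as ≤-refl

macaulay : ∀ E → MacaulayBound E
macaulay zero    = macaulay₀
macaulay (suc e) = MacaulayStep.macaulay-suc e (macaulay e)

-- The gap encoding of faces

IncreasingFrom : ℕ → List ℕ → Set
IncreasingFrom b xs = Linked _<_ xs × All (b ≤_) xs

IncreasingFrom-tail : ∀ {b x xs} → IncreasingFrom b (x ∷ xs) → IncreasingFrom (suc x) xs
IncreasingFrom-tail (linked , _) with Linked⇒AllPairs <-trans linked
... | above ∷ _ = Linked.tail linked , above

gaps : ℕ → List ℕ → List ℕ
gaps b []       = []
gaps b (x ∷ xs) = (x ∸ b) ∷ gaps (suc x) xs

positions : ℕ → List ℕ → List ℕ
positions b []       = []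
positions b (z ∷ zs) = (b + z) ∷ positions (suc (b + z)) zs

gaps-positions : ∀ b zs → gaps b (positions b zs) ≡ zs
gaps-positions b []       = refl
gaps-positions b (z ∷ zs) = cong₂ _∷_ (m+n∸m≡n b z) (gaps-positions (suc (b + z)) zs)

positions-gaps : ∀ b xs → IncreasingFrom b xs → positions b (gaps b xs) ≡ xs
positions-gaps b []       _                   = refl
positions-gaps b (x ∷ xs) inc@(_ , b≤x ∷ _) rewrite m+[n∸m]≡n b≤x =
  cong (x ∷_) (positions-gaps (suc x) xs (IncreasingFrom-tail inc))

length-gaps : ∀ b xs → length (gaps b xs) ≡ length xs
length-gaps b []       = refl
length-gaps b (x ∷ xs) = cong suc (length-gaps (suc x) xs)

positions-suc : ∀ b zs → positions (suc b) zs ≡ map suc (positions b zs)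
positions-suc b []       = refl
positions-suc b (z ∷ zs) = cong (suc (b + z) ∷_) (positions-suc (suc (b + z)) zs)

positions-keep : ∀ {b x} zs → b ≤ x → positions b ((x ∸ b) ∷ zs) ≡ x ∷ positions (suc x) zs
positions-keep zs b≤x = cong (λ y → y ∷ positions (suc y) zs) (m+[n∸m]≡n b≤x)

positions-raise : ∀ {b x} xs → IncreasingFrom b (x ∷ xs) → positions b (suc (x ∸ b) ∷ gaps (suc x) xs) ≡ suc x ∷ map suc xs
positions-raise {b} {x} xs inc@(_ , b≤x ∷ _) = begin
  positions b (suc (x ∸ b) ∷ gaps (suc x) xs)
    ≡⟨ cong (λ y → y ∷ positions (suc y) (gaps (suc x) xs)) (trans (+-suc b (x ∸ b)) (cong suc (m+[n∸m]≡n b≤x))) ⟩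
  suc x ∷ positions (suc (suc x)) (gaps (suc x) xs)
    ≡⟨ cong (suc x ∷_) (positions-suc (suc x) (gaps (suc x) xs)) ⟩
  suc x ∷ map suc (positions (suc x) (gaps (suc x) xs))
    ≡⟨ cong (λ ys → suc x ∷ map suc ys) (positions-gaps (suc x) xs (IncreasingFrom-tail inc)) ⟩
  suc x ∷ map suc xs ∎
  where open ≡-Reasoning

shiftFrom : ℕ → ℕ → ℕ
shiftFrom t j with j <? t
... | yes _ = j
... | no  _ = suc j

shiftFrom-below : ∀ {t j} → j < t → shiftFrom t j ≡ j
shiftFrom-below {t} {j} j<t with j <? t
... | yes _   = refl
... | no  j≮t = ⊥-elim (j≮t j<t)

shiftFrom-above : ∀ {t j} → t ≤ j → shiftFrom t j ≡ suc j
shiftFrom-above {t} {j} t≤j with j <? t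
... | yes j<t = ⊥-elim (<⇒≱ j<t t≤j)
... | no  _   = refl

shiftFrom-Inc1 : ∀ t → IsInc1 (shiftFrom t)
shiftFrom-Inc1 t = record { pos = positive ; incr = increasing ; bnd = bounded }
  where
    positive : 1 ≤ shiftFrom t 1
    positive with 1 <? t
    ... | yes _ = ≤-refl
    ... | no  _ = s≤s z≤n
    increasing : ∀ j → 1 ≤ j → shiftFrom t j < shiftFrom t (suc j)
    increasing j _ with j <? t | suc j <? t
    ... | yes _   | yes _     = ≤-refl
    ... | yes _   | no  _     = <-trans (n<1+n j) (n<1+n (suc j))
    ... | no  j≮t | yes 1+j<t = ⊥-elim (j≮t (<-trans (n<1+n j) 1+j<t))
    ... | no  _   | no  _     = ≤-refl
    bounded : ∀ j → 1 ≤ j → shiftFrom t j ≤ suc j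
    bounded j _ with j <? t
    ... | yes _ = n≤1+n j
    ... | no  _ = ≤-refl

-- Every π ∈ Inc₁ fixes an initial segment of positions and shifts the rest.
module Inc1 {π : ℕ → ℕ} (inc1 : IsInc1 π) where
  open IsInc1 inc1

  j≤π[j] : ∀ j → 1 ≤ j → j ≤ π j
  j≤π[j] (suc zero)    _ = pos
  j≤π[j] (suc (suc j)) _ = ≤-trans (s≤s (j≤π[j] (suc j) (s≤s z≤n))) (incr (suc j) (s≤s z≤n))

  fixes-or-shifts : ∀ j → 1 ≤ j → π j ≡ j ⊎ π j ≡ suc j
  fixes-or-shifts j 1≤j with π j ≟ j
  ... | yes fixed = inj₁ fixed
  ... | no  moved = inj₂ (≤-antisym (bnd j 1≤j) (≤∧≢⇒< (j≤π[j] j 1≤j) (λ eq → moved (sym eq))))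

  shifts-onwards : ∀ j k → 1 ≤ j → j ≤ k → π j ≡ suc j → π k ≡ suc k
  shifts-onwards j k 1≤j j≤k shifted with m≤n⇒m<n∨m≡n j≤k
  ... | inj₂ refl = shifted
  shifts-onwards j (suc k) 1≤j _ shifted | inj₁ (s≤s j≤k) =
    ≤-antisym (bnd (suc k) (s≤s z≤n)) (subst (_< π (suc k)) (shifts-onwards j k 1≤j j≤k shifted) (incr k (≤-trans 1≤j j≤k)))

  image∈steps : ∀ b xs → 1 ≤ b → IncreasingFrom b xs → Σ (List ℕ) λ c → c ∈ steps (gaps b xs) × positions b c ≡ map π xs
  image∈steps b []       _   _                    = [] , here refl , refl
  image∈steps b (x ∷ xs) 1≤b inc@(_ , b≤x ∷ _) with fixes-or-shifts x (≤-trans 1≤b b≤x)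
  ... | inj₁ fixed =
    let (c , c∈ , c≡) = image∈steps (suc x) xs (s≤s z≤n) (IncreasingFrom-tail inc)
    in (x ∸ b) ∷ c , ∷-steps c∈ , trans (positions-keep c b≤x) (cong₂ _∷_ (sym fixed) c≡)
  ... | inj₂ shifted =
    suc (x ∸ b) ∷ gaps (suc x) xs , bump∈steps 0 (gaps b (x ∷ xs)) ,
    trans (positions-raise xs inc)
          (cong₂ _∷_ (sym shifted) (sym (map-cong-local (All.map (λ x<y → shifts-onwards x _ (≤-trans 1≤b b≤x) (<⇒≤ x<y) shifted)
                                                                   (proj₂ (IncreasingFrom-tail inc))))))

steps⇒shift : ∀ b xs → IncreasingFrom b xs → ∀ {c} → c ∈ steps (gaps b xs) →
              Σ ℕ λ t → positions b c ≡ map (shiftFrom t) xs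
steps⇒shift b []       _                 (here refl) = 1 , refl
steps⇒shift b (x ∷ xs) inc@(_ , b≤x ∷ _) p with ∈-++⁻ (map ((x ∸ b) ∷_) (steps (gaps (suc x) xs))) p
... | inj₁ q with ∈-map⁻ ((x ∸ b) ∷_) q
...   | c , c∈ , refl with steps⇒shift (suc x) xs (IncreasingFrom-tail inc) c∈
...     | t , c≡ =
  t ⊔ suc x ,
  trans (positions-keep c b≤x)
        (cong₂ _∷_ (sym (shiftFrom-below (m≤n⊔m t (suc x))))
                   (trans c≡ (map-cong-local (All.map same-shift (proj₂ (IncreasingFrom-tail inc))))))
  where
    same-shift : ∀ {y} → suc x ≤ y → shiftFrom t y ≡ shiftFrom (t ⊔ suc x) y
    same-shift {y} x<y with y <? t
    ... | yes y<t = sym (shiftFrom-below (≤-trans y<t (m≤m⊔n t (suc x))))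
    ... | no  y≮t = sym (shiftFrom-above (⊔-lub (≮⇒≥ y≮t) x<y))
steps⇒shift b (x ∷ xs) inc p | inj₂ (here refl) =
  x , trans (positions-raise xs inc)
            (cong₂ _∷_ (sym (shiftFrom-above ≤-refl))
                       (map-cong-local (All.map (λ x<y → sym (shiftFrom-above (<⇒≤ x<y))) (proj₂ (IncreasingFrom-tail inc)))))

-- For the (d+1)-faces of Δ, with gap vectors gapFamily, the d-faces of
-- Inc(Δ) are enumerated by decoding the shadow of gapFamily.
module Orbit (Δ : List (List ℕ)) (complex : IsComplex Δ) (d : ℕ) where
  private
    ∈faces⁻ : ∀ {u} → u ∈ F (suc d) Δ → u ∈ Δ × length u ≡ suc d
    ∈faces⁻ = ∈-filter⁻ (λ u → length u ≟ suc d) {xs = Δ}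

    increasing : ∀ {u} → u ∈ F (suc d) Δ → IncreasingFrom 1 u
    increasing p = All.lookup (IsComplex.faces complex) (proj₁ (∈faces⁻ p))

  gapFamily : List (List ℕ)
  gapFamily = map (gaps 1) (F (suc d) Δ)

  gapFamily-family : Family (suc d) gapFamily
  gapFamily-family =
    map-unique-on (gaps 1) (filter⁺ (λ u → length u ≟ suc d) (IsComplex.unique complex)) gaps-injective ,
    All.tabulate length≡
    where
      gaps-injective : ∀ {a b} → a ∈ F (suc d) Δ → b ∈ F (suc d) Δ → gaps 1 a ≡ gaps 1 b → a ≡ b
      gaps-injective {a} {b} pa pb eq =
        trans (sym (positions-gaps 1 a (increasing pa))) (trans (cong (positions 1) eq) (positions-gaps 1 b (increasing pb)))
      length≡ : ∀ {v} → v ∈ gapFamily → length v ≡ suc d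
      length≡ p with ∈-map⁻ (gaps 1) p
      ... | u , u∈ , refl = trans (length-gaps 1 u) (proj₂ (∈faces⁻ u∈))

  orbit : List (List ℕ)
  orbit = map (positions 1) (shadow gapFamily)

  orbit-unique : Unique orbit
  orbit-unique = map-unique-on (positions 1) (shadow-unique gapFamily)
    (λ {a} {b} _ _ eq → trans (sym (gaps-positions 1 a)) (trans (cong (gaps 1) eq) (gaps-positions 1 b)))

  ∈orbit⇔ : ∀ v → (v ∈ orbit) ⇔ (InInc Δ v × length v ≡ suc d)
  ∈orbit⇔ v = mk⇔ to from
    where
      to : v ∈ orbit → InInc Δ v × length v ≡ suc d
      to p with ∈-map⁻ (positions 1) p
      ... | c , c∈ , v≡ with ∈shadow⁻ c∈
      ...   | _ , u'∈ , c∈steps with ∈-map⁻ (gaps 1) u'∈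
      ...     | u , u∈ , refl with steps⇒shift 1 u (increasing u∈) c∈steps
      ...       | t , c≡ =
        let (u∈Δ , length-u) = ∈faces⁻ u∈ in
        (u , u∈Δ , subst (1 ≤_) (sym length-u) (s≤s z≤n) , shiftFrom t , shiftFrom-Inc1 t , trans v≡ c≡) ,
        trans (cong length (trans v≡ c≡)) (trans (length-map (shiftFrom t) u) length-u)

      from : InInc Δ v × length v ≡ suc d → v ∈ orbit
      from ((u , u∈Δ , _ , π , inc1 , v≡) , length-v) =
        let u∈faces = ∈-filter⁺ (λ u → length u ≟ suc d) u∈Δ (trans (sym (length-map π u)) (trans (cong length (sym v≡)) length-v))
            (c , c∈steps , c≡) = Inc1.image∈steps inc1 1 u ≤-refl (increasing u∈faces)
        in subst (_∈ orbit) (trans c≡ (sym v≡))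
                 (∈-map⁺ (positions 1) (shadow-contains gapFamily (∈-map⁺ (gaps 1) u∈faces) c∈steps))

  orbit-bound : ∀ as → Rep (suc d) as → binSum (suc d) as ≡ f d Δ → incSum (suc d) as ≤ length orbit
  orbit-bound as rep m≡ =
    subst (incSum (suc d) as ≤_) (sym (length-map (positions 1) (shadow gapFamily)))
      (+-cancelˡ-≤ m (incSum (suc d) as) (length (shadow gapFamily))
        (subst₂ _≤_ (cong (_+ incSum (suc d) as) |G|≡m) (+-comm (length (shadow gapFamily)) m)
          (macaulay (suc d) gapFamily (shadow gapFamily) as gapFamily-family (shadow-unique gapFamily)
                    (shadow-contains gapFamily) (Rep⇒BinRep rep) (≤-reflexive (sym |G|≡m)))))
    where
      m : ℕ
      m = binSum (suc d) as
      |G|≡m : length gapFamily ≡ m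
      |G|≡m = trans (length-map (gaps 1) (F (suc d) Δ)) (sym m≡)

corollary4p3 : (Δ : List (List ℕ)) → IsComplex Δ → (d : ℕ) →
    Σ (List (List ℕ)) λ L →
      Unique L ×
      (∀ v → (v ∈ L) ⇔ (InInc Δ v × length v ≡ suc d)) ×
      (∀ as → Rep (suc d) as → binSum (suc d) as ≡ f d Δ → incSum (suc d) as ≤ length L)
corollary4p3 Δ complex d = orbit , orbit-unique , ∈orbit⇔ , orbit-bound
  where open Orbit Δ complex d
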